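{- Let $f$ be a non-negative submodular function on a finite ground set $N$, $c:N\to\mathbb{R}_{>0}$ costs and $B$ a budget. Run the Twin Greedy algorithm described in the context, with the notation $t$, $u_j$, $S_k^j$ defined there. For any $k\in\{1,2\}$, let $\ell=3-k$. For fixed $i\in\{1,\dots,t\}$, if $c(S_k^{i-1})<B$, then for every subset $T\subseteq S_\ell^i$, \[ f(T\mid S_k^i)\le\sum_{j:\,u_j\in T} f(u_j\mid S_\ell^{j-1}). \]
   Context: Notation: $c(S)=\sum_{u\in S}c(u)$, $f(u\mid S)=f(S\cup\{u\})-f(S)$, $f(T\mid S)=f(T\cup S)-f(S)$. Twin Greedy (input $N,f,c,B$): $S_1\gets\emptyset$, $S_2\gets\emptyset$, $J\gets\{1,2\}$. While $N\neq\emptyset$ and $J\neq\emptyset$: let $(k,u)\in\arg\max_{k'\in J,u'\in N} f(u'\mid S_{k'})/c(u')$; if $f(u\mid S_k)\le 0$, stop the loop; otherwise $S_k\gets S_k\cup\{u\}$, if $c(S_k)\ge B$ then $J\gets J\setminus\{k\}$, and $N\gets N\setminus\{u\}$. Return the one of $S_1,S_2$ with larger $f$-value. Notation for the run: $t$ is the number of elements added in total, $u_j$ ($j=1,\dots,t$) is the $j$-th element added, $S_k^j=S_k\cap\{u_1,\dots,u_j\}$ is the $k$-th candidate after the $j$-th addition ($S_k^0=\emptyset$), and $S_k$ is the final $k$-th candidate. -}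

module Defs where

open import Level using (0ℓ)
open import Data.Bool using (Bool; true; false; if_then_else_)
open import Data.Nat using (ℕ; zero; suc)
open import Data.Fin using (Fin; zero; suc; toℕ; _≟_)
open import Data.Fin.Subset using (Subset; ⊥; ⁅_⁆; _∪_; _∩_; _-_; _∈_; _⊆_; Empty)
open import Data.Vec using (lookup)
open import Data.List using (List; []; _∷_; take; length)
import Data.List as List
open import Data.Product using (_×_; _,_; proj₁; proj₂)
open import Data.Sum using (_⊎_)
open import Relation.Nullary using (¬_; does)
open import Relation.Binary.PropositionalEquality using (_≡_; _≢_)
open import Relation.Binary.Structures using (IsTotalOrder)
open import Algebra.Structures using (IsCommutativeRing)

-- An ordered field (the real numbers are one).  The statement is proved
-- for every ordered field, in particular for ℝ.  Inverse is total with
-- the only requirement  x ≢ 0 → x * x⁻¹ ≡ 1.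

record OrderedField : Set₁ where
  infixl 6 _+_
  infixl 7 _*_
  infix 4 _≤_ _<_
  field
    Carrier : Set
    _+_ _*_ : Carrier → Carrier → Carrier
    -_ : Carrier → Carrier
    _⁻¹ : Carrier → Carrier
    0# 1# : Carrier
    _≤_ : Carrier → Carrier → Set
    isCommutativeRing : IsCommutativeRing _≡_ _+_ _*_ -_ 0# 1#
    isTotalOrder : IsTotalOrder _≡_ _≤_
    +-monoˡ-≤ : ∀ {x y} z → x ≤ y → x + z ≤ y + z
    *-nonneg : ∀ {x y} → 0# ≤ x → 0# ≤ y → 0# ≤ x * y
    0≢1 : 0# ≢ 1#
    *-inverse : ∀ x → x ≢ 0# → x * (x ⁻¹) ≡ 1#

  _<_ : Carrier → Carrier → Set
  x < y = x ≤ y × x ≢ y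

  _−_ : Carrier → Carrier → Carrier
  x − y = x + (- y)

  sumFin : ∀ m → (Fin m → Carrier) → Carrier
  sumFin zero    g = 0#
  sumFin (suc m) g = g zero + sumFin m (λ j → g (suc j))

module TwinGreedy (F : OrderedField) {n : ℕ}
                  (f : Subset n → OrderedField.Carrier F)
                  (c : Fin n → OrderedField.Carrier F)
                  (B : OrderedField.Carrier F) where
  open OrderedField F

  cost : Subset n → Carrier
  cost S = sumFin n (λ u → if lookup S u then c u else 0#)

  marg : Subset n → Subset n → Carrier
  marg T S = f (T ∪ S) − f S

  margₑ : Fin n → Subset n → Carrier
  margₑ u S = f (S ∪ ⁅ u ⁆) − f S

  -- state of the loop: the two candidates S₁,S₂ (indexed by Fin 2),
  -- the remaining ground set N and the active index set J
  record State : Set where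
    constructor st
    field
      S  : Fin 2 → Subset n
      N  : Subset n
      J  : Subset 2
  open State public

  initial : State
  initial = st (λ _ → ⊥) (Data.Vec.replicate n true) (Data.Vec.replicate 2 true)

  ratio : State → Fin 2 → Fin n → Carrier
  ratio s k u = margₑ u (S s k) * (c u ⁻¹)

  IsArgmax : State → Fin 2 → Fin n → Set
  IsArgmax s k u =
    k ∈ J s × u ∈ N s ×
    (∀ k' u' → k' ∈ J s → u' ∈ N s → ratio s k' u' ≤ ratio s k u)

  addTo : (Fin 2 → Subset n) → Fin 2 → Fin n → Fin 2 → Subset n
  addTo S k u k' = if does (k' ≟ k) then S k' ∪ ⁅ u ⁆ else S k'

  NextJ : State → Fin 2 → Fin n → Subset 2 → Set
  NextJ s k u J' =
    (B ≤ cost (addTo (S s) k u k) → J' ≡ J s - k) ×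
    (¬ (B ≤ cost (addTo (S s) k u k)) → J' ≡ J s)

  -- Run s steps : the loop started in state s performs exactly the
  -- additions listed in steps (pairs (k , u): u added to S_k), then stops.
  data Run : State → List (Fin 2 × Fin n) → Set where
    stop-exhausted : ∀ {s} → Empty (N s) ⊎ Empty (J s) → Run s []
    stop-nonpos : ∀ {s} k u → IsArgmax s k u →
                  margₑ u (S s k) ≤ 0# → Run s []
    step : ∀ {s} k u J' {rest} → IsArgmax s k u →
           ¬ (margₑ u (S s k) ≤ 0#) → NextJ s k u J' →
           Run (st (addTo (S s) k u) (N s - u) J') rest →
           Run s ((k , u) ∷ rest)

  collect : Fin 2 → List (Fin 2 × Fin n) → Subset n
  collect k [] = ⊥
  collect k ((k' , u) ∷ rest) =
    if does (k ≟ k') then ⁅ u ⁆ ∪ collect k rest else collect k rest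

  -- S_k^j = S_k ∩ {u_1,…,u_j}
  Sᵏ : List (Fin 2 × Fin n) → Fin 2 → ℕ → Subset n
  Sᵏ steps k j = collect k (take j steps)

  -- u_{j+1} for j : Fin t  (0-based index into the run)
  elem : (steps : List (Fin 2 × Fin n)) → Fin (length steps) → Fin n
  elem steps j = proj₂ (List.lookup steps j)

  -- Σ_{j : u_j ∈ T} f(u_j | S_ℓ^{j-1})   (written with 0-based j)
  rhsSum : (steps : List (Fin 2 × Fin n)) → Fin 2 → Subset n → Carrier
  rhsSum steps ℓ T =
    sumFin (length steps) (λ j →
      if lookup T (elem steps j)
      then margₑ (elem steps j) (Sᵏ steps ℓ (toℕ j))
      else 0#)

  NonNegative : Set
  NonNegative = ∀ S → 0# ≤ f S

  Submodular : Set
  Submodular = ∀ A C → f (A ∪ C) + f (A ∩ C) ≤ f A + f C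

other : Fin 2 → Fin 2
other zero = suc zero
other (suc _) = zero

-- Let A = S_k^i. By submodularity, and since the added elements u_j are
-- distinct, f(T | A) ≤ Σ_{u_j ∈ T} f(u_j | A). Each u_j ∈ T was added to S_ℓ at
-- a step j ≤ i, when S_k^{j-1} ⊆ S_k^{i-1} was still under budget; so k was
-- active and the greedy rule gives f(u_j | S_k^{j-1}) ≤ f(u_j | S_ℓ^{j-1}).
-- Finally u_j ∉ A ⊇ S_k^{j-1}, so diminishing returns give
-- f(u_j | A) ≤ f(u_j | S_k^{j-1}).
module Submission where

open import Defs
open import Data.Nat using (ℕ; suc; _∸_) renaming (_≤_ to _≤ℕ_)
open import Data.Fin using (Fin)
open import Data.Fin.Subset using (Subset; _⊆_)
open import Data.List using (List; length)
open import Data.Product using (_×_)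

open import Algebra.Bundles using (Ring)
open import Algebra.Structures using (IsCommutativeRing)
import Algebra.Properties.Ring as RingProperties
open import Data.Bool using (true; false; if_then_else_)
open import Data.Empty using (⊥-elim)
open import Data.Fin using (zero; suc; toℕ; _≟_)
open import Data.Fin.Subset using (⊥; ⁅_⁆; _∪_; _∩_; _─_; _-_; _∈_; _∉_)
open import Data.Fin.Subset.Properties
open import Data.List using ([]; _∷_; take)
import Data.List as List
open import Data.Nat using (z≤n; s≤s) renaming (zero to zeroℕ; _<_ to _<ℕ_)
import Data.Nat.Properties as ℕ
open import Data.Product using (_,_; proj₁; proj₂; map₁)
open import Data.Sum using (inj₁; inj₂; [_,_]′; map₂)
open import Data.Vec using (lookup; here; there; _∷_)
open import Data.Vec.Properties using ([]=⇒lookup; lookup⇒[]=)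
open import Relation.Binary.Bundles using (Poset)
open import Relation.Binary.PropositionalEquality
  using (_≡_; _≢_; refl; sym; trans; cong; subst; subst₂; module ≡-Reasoning)
open import Relation.Binary.Structures using (IsTotalOrder)
open import Relation.Nullary using (¬_; yes; no; does)
open import Relation.Nullary.Decidable using (decidable-stable)
import Relation.Binary.Reasoning.PartialOrder
open import Function using (_∘′_; id)

module OrderedFieldProperties (F : OrderedField) where
  open OrderedField F
  open IsCommutativeRing isCommutativeRing
    using (+-comm; +-assoc; +-identityˡ; +-identityʳ; -‿inverseˡ; -‿inverseʳ;
           *-assoc; *-comm; *-identityʳ; distribʳ; isRing)
  open IsTotalOrder isTotalOrder using (isPartialOrder)
  open IsTotalOrder isTotalOrder public
    using () renaming (reflexive to ≤-reflexive; antisym to ≤-antisym; trans to ≤-trans)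

  private
    ring : Ring _ _
    ring = record { isRing = isRing }
  open RingProperties ring using (-‿distribˡ-*)

  ≤-poset : Poset _ _ _
  ≤-poset = record { isPartialOrder = isPartialOrder }

  +-cancel-middle : ∀ x {y z} w → y + z ≡ 0# → (x + y) + (z + w) ≡ x + w
  +-cancel-middle x {y} {z} w y+z≡0 = begin
    (x + y) + (z + w)  ≡⟨ +-assoc x y (z + w) ⟩
    x + (y + (z + w))  ≡⟨ cong (x +_) (sym (+-assoc y z w)) ⟩
    x + ((y + z) + w)  ≡⟨ cong (λ t → x + (t + w)) y+z≡0 ⟩
    x + (0# + w)       ≡⟨ cong (x +_) (+-identityˡ w) ⟩
    x + w              ∎
    where open ≡-Reasoning

  telescope : ∀ x y z → (x − y) + (y − z) ≡ x − z
  telescope x y z = +-cancel-middle x (- z) (-‿inverseˡ y)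

  +-monoʳ-≤ : ∀ z {x y} → x ≤ y → z + x ≤ z + y
  +-monoʳ-≤ z {x} {y} x≤y = subst₂ _≤_ (+-comm x z) (+-comm y z) (+-monoˡ-≤ z x≤y)

  +-mono-≤ : ∀ {x y z w} → x ≤ y → z ≤ w → x + z ≤ y + w
  +-mono-≤ {y = y} {z} x≤y z≤w = ≤-trans (+-monoˡ-≤ z x≤y) (+-monoʳ-≤ y z≤w)

  x+y≤z+w⇒x−w≤z−y : ∀ {x y z w} → x + y ≤ z + w → x − w ≤ z − y
  x+y≤z+w⇒x−w≤z−y {x} {y} {z} {w} le =
    subst₂ _≤_ (+-cancel-middle x (- w) (-‿inverseʳ y)) rhs (+-monoˡ-≤ (- y + - w) le)
    where
    rhs : (z + w) + (- y + - w) ≡ z − y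
    rhs = trans (cong ((z + w) +_) (+-comm (- y) (- w))) (+-cancel-middle z (- y) (-‿inverseʳ w))

  x≤y⇒0≤y−x : ∀ {x y} → x ≤ y → 0# ≤ y − x
  x≤y⇒0≤y−x {x} {y} x≤y = subst (_≤ y − x) (-‿inverseʳ x) (+-monoˡ-≤ (- x) x≤y)

  0≤y−x⇒x≤y : ∀ {x y} → 0# ≤ y − x → x ≤ y
  0≤y−x⇒x≤y {x} {y} 0≤y−x = subst₂ _≤_ (+-identityˡ x) y−x+x≡y (+-monoˡ-≤ x 0≤y−x)
    where
    y−x+x≡y : (y − x) + x ≡ y
    y−x+x≡y = trans (+-assoc y (- x) x) (trans (cong (y +_) (-‿inverseˡ x)) (+-identityʳ y))

  *-monoˡ-≤-nonNeg : ∀ {x y} z → 0# ≤ z → x ≤ y → x * z ≤ y * z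
  *-monoˡ-≤-nonNeg {x} {y} z 0≤z x≤y = 0≤y−x⇒x≤y (subst (0# ≤_) distrib (*-nonneg (x≤y⇒0≤y−x x≤y) 0≤z))
    where
    distrib : (y − x) * z ≡ (y * z) − (x * z)
    distrib = trans (distribʳ z y (- x)) (cong (y * z +_) (sym (-‿distribˡ-* x z)))

  *-inverse-cancelʳ-≤ : ∀ {x y z} → 0# < z → x * z ⁻¹ ≤ y * z ⁻¹ → x ≤ y
  *-inverse-cancelʳ-≤ {x} {y} {z} (0≤z , 0≢z) le =
    subst₂ _≤_ (cancel x) (cancel y) (*-monoˡ-≤-nonNeg z 0≤z le)
    where
    cancel : ∀ t → t * z ⁻¹ * z ≡ t
    cancel t = begin
      t * z ⁻¹ * z    ≡⟨ *-assoc t (z ⁻¹) z ⟩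
      t * (z ⁻¹ * z)  ≡⟨ cong (t *_) (*-comm (z ⁻¹) z) ⟩
      t * (z * z ⁻¹)  ≡⟨ cong (t *_) (*-inverse z (0≢z ∘′ sym)) ⟩
      t * 1#          ≡⟨ *-identityʳ t ⟩
      t               ∎
      where open ≡-Reasoning

  ≤-<-trans : ∀ {x y z} → x ≤ y → y < z → x < z
  ≤-<-trans {x} {y} x≤y (y≤z , y≢z) =
    ≤-trans x≤y y≤z , λ x≡z → y≢z (≤-antisym y≤z (subst (_≤ y) x≡z x≤y))

  <⇒≱ : ∀ {x y} → x < y → ¬ (y ≤ x)
  <⇒≱ (x≤y , x≢y) y≤x = x≢y (≤-antisym x≤y y≤x)

  sumFin-mono-≤ : ∀ m {g h : Fin m → Carrier} → (∀ j → g j ≤ h j) → sumFin m g ≤ sumFin m h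
  sumFin-mono-≤ zeroℕ   g≤h = ≤-reflexive refl
  sumFin-mono-≤ (suc m) g≤h = +-mono-≤ (g≤h zero) (sumFin-mono-≤ m (λ j → g≤h (suc j)))

x∈p─q⇒x∉q : ∀ {n} {x : Fin n} (p q : Subset n) → x ∈ p ─ q → x ∉ q
x∈p─q⇒x∉q (true ∷ p)  (false ∷ q) here         ()
x∈p─q⇒x∉q (_ ∷ p)     (_ ∷ q)     (there x∈p─q) (there x∈q) = x∈p─q⇒x∉q p q x∈p─q x∈q

m<n⇒m≤n∸1 : ∀ {m n} → m <ℕ n → m ≤ℕ n ∸ 1
m<n⇒m≤n∸1 (s≤s m≤n) = m≤n

other-≢ : ∀ k → k ≢ other k
other-≢ zero    ()
other-≢ (suc _) ()

module _ {n : ℕ} where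

  x∉p-x : ∀ {x : Fin n} (p : Subset n) → x ∉ p - x
  x∉p-x {x} p x∈p-x = x∈p─q⇒x∉q p ⁅ x ⁆ x∈p-x (x∈⁅x⁆ x)

  p⊆q⇒p∪q≡q : ∀ {p q : Subset n} → p ⊆ q → p ∪ q ≡ q
  p⊆q⇒p∪q≡q {p} {q} p⊆q = ⊆-antisym (λ x∈ → [ p⊆q , id ]′ (x∈p∪q⁻ p q x∈)) (q⊆p∪q p q)

  p⊆q⇒p∩q≡p : ∀ {p q : Subset n} → p ⊆ q → p ∩ q ≡ p
  p⊆q⇒p∩q≡p {p} {q} p⊆q = ⊆-antisym (p∩q⊆p p q) (λ x∈p → x∈p∩q⁺ (x∈p , p⊆q x∈p))

  x∈p⇒⁅x⁆⊆p : ∀ {x : Fin n} {p} → x ∈ p → ⁅ x ⁆ ⊆ p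
  x∈p⇒⁅x⁆⊆p {x} {p} x∈p y∈⁅x⁆ = subst (_∈ p) (sym (x∈⁅y⁆⇒x≡y x y∈⁅x⁆)) x∈p

  x∉p⇒p∩⁅x⁆≡⊥ : ∀ {x : Fin n} {p} → x ∉ p → p ∩ ⁅ x ⁆ ≡ ⊥
  x∉p⇒p∩⁅x⁆≡⊥ {x} {p} x∉p = Empty-unique λ where
    (y , y∈p∩⁅x⁆) → let y∈p , y∈⁅x⁆ = x∈p∩q⁻ p ⁅ x ⁆ y∈p∩⁅x⁆
                    in x∉p (subst (_∈ p) (x∈⁅y⁆⇒x≡y x y∈⁅x⁆) y∈p)

  lookup≡false⇒∉ : ∀ {x : Fin n} {p} → lookup p x ≡ false → x ∉ p
  lookup≡false⇒∉ p[x]≡false x∈p with () ← trans (sym ([]=⇒lookup x∈p)) p[x]≡false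

  ∪-monoʳ-⊆ : ∀ (p : Subset n) {q r} → q ⊆ r → p ∪ q ⊆ p ∪ r
  ∪-monoʳ-⊆ p {q} {r} q⊆r x∈ = x∈p∪q⁺ (map₂ q⊆r (x∈p∪q⁻ p q x∈))

module TwinGreedyProperties (F : OrderedField) {n : ℕ}
                            (f : Subset n → OrderedField.Carrier F)
                            (c : Fin n → OrderedField.Carrier F)
                            (B : OrderedField.Carrier F) where
  open OrderedField F
  open TwinGreedy F f c B
  open OrderedFieldProperties F
  open IsCommutativeRing isCommutativeRing using (+-identityˡ; -‿inverseʳ)
  module ≤-Reasoning = Relation.Binary.Reasoning.PartialOrder ≤-poset

  Step : Set
  Step = Fin 2 × Fin n

  added : List Step → Subset n
  added []             = ⊥
  added ((_ , u) ∷ xs) = ⁅ u ⁆ ∪ added xs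

  data Distinct : List Step → Set where
    []  : Distinct []
    _∷_ : ∀ {k u xs} → u ∉ added xs → Distinct xs → Distinct ((k , u) ∷ xs)

  marg-⁅⁆∪ : ∀ u W A → marg (⁅ u ⁆ ∪ W) A ≡ margₑ u (W ∪ A) + marg W A
  marg-⁅⁆∪ u W A = begin
    f ((⁅ u ⁆ ∪ W) ∪ A) − f A                      ≡⟨ cong (λ X → f X − f A) regroup ⟩
    f ((W ∪ A) ∪ ⁅ u ⁆) − f A                      ≡⟨ telescope _ (f (W ∪ A)) (f A) ⟨
    margₑ u (W ∪ A) + marg W A                     ∎
    where
    open ≡-Reasoning
    regroup : (⁅ u ⁆ ∪ W) ∪ A ≡ (W ∪ A) ∪ ⁅ u ⁆
    regroup = trans (∪-assoc ⁅ u ⁆ W A) (∪-comm ⁅ u ⁆ (W ∪ A))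

  sumMargₑ : List Step → Subset n → Subset n → Carrier
  sumMargₑ xs T A = sumFin (length xs) (λ j → if lookup T (elem xs j) then margₑ (elem xs j) A else 0#)

  module _ (submodular : Submodular) where

    margₑ-antitone : ∀ {C A} u → C ⊆ A → (u ∈ A → u ∈ C) → margₑ u A ≤ margₑ u C
    margₑ-antitone {C} {A} u C⊆A u∈A⇒u∈C =
      x+y≤z+w⇒x−w≤z−y (subst₂ (λ X Y → f X + f Y ≤ f (C ∪ ⁅ u ⁆) + f A) union intersection
                                (submodular (C ∪ ⁅ u ⁆) A))
      where
      open ≡-Reasoning
      union : (C ∪ ⁅ u ⁆) ∪ A ≡ A ∪ ⁅ u ⁆
      union = begin
        (C ∪ ⁅ u ⁆) ∪ A  ≡⟨ cong (_∪ A) (∪-comm C ⁅ u ⁆) ⟩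
        (⁅ u ⁆ ∪ C) ∪ A  ≡⟨ ∪-assoc ⁅ u ⁆ C A ⟩
        ⁅ u ⁆ ∪ (C ∪ A)  ≡⟨ cong (⁅ u ⁆ ∪_) (p⊆q⇒p∪q≡q C⊆A) ⟩
        ⁅ u ⁆ ∪ A        ≡⟨ ∪-comm ⁅ u ⁆ A ⟩
        A ∪ ⁅ u ⁆        ∎
      ⁅u⁆∩A⊆C : ⁅ u ⁆ ∩ A ⊆ C
      ⁅u⁆∩A⊆C x∈ = let x∈⁅u⁆ , x∈A = x∈p∩q⁻ ⁅ u ⁆ A x∈ in
        x∈p⇒⁅x⁆⊆p (u∈A⇒u∈C (subst (_∈ A) (x∈⁅y⁆⇒x≡y u x∈⁅u⁆) x∈A)) x∈⁅u⁆
      intersection : (C ∪ ⁅ u ⁆) ∩ A ≡ C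
      intersection = begin
        (C ∪ ⁅ u ⁆) ∩ A        ≡⟨ ∩-distribʳ-∪ A C ⁅ u ⁆ ⟩
        (C ∩ A) ∪ (⁅ u ⁆ ∩ A)  ≡⟨ cong (_∪ (⁅ u ⁆ ∩ A)) (p⊆q⇒p∩q≡p C⊆A) ⟩
        C ∪ (⁅ u ⁆ ∩ A)        ≡⟨ ∪-comm C (⁅ u ⁆ ∩ A) ⟩
        (⁅ u ⁆ ∩ A) ∪ C        ≡⟨ p⊆q⇒p∪q≡q ⁅u⁆∩A⊆C ⟩
        C                      ∎

    marg-≤-sumMargₑ : ∀ A T xs → Distinct xs → marg (T ∩ added xs) A ≤ sumMargₑ xs T A
    marg-≤-sumMargₑ A T [] [] = ≤-reflexive (begin
      f ((T ∩ ⊥) ∪ A) − f A  ≡⟨ cong (λ X → f (X ∪ A) − f A) (∩-zeroʳ T) ⟩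
      f (⊥ ∪ A) − f A        ≡⟨ cong (λ X → f X − f A) (∪-identityˡ A) ⟩
      f A − f A              ≡⟨ -‿inverseʳ (f A) ⟩
      0#                     ∎)
      where open ≡-Reasoning
    marg-≤-sumMargₑ A T ((_ , u) ∷ xs) (u∉xs ∷ distinct) with lookup T u in T[u]
    ... | true = begin
      marg (T ∩ (⁅ u ⁆ ∪ added xs)) A  ≡⟨ cong (λ X → marg X A) split ⟩
      marg (⁅ u ⁆ ∪ W) A               ≡⟨ marg-⁅⁆∪ u W A ⟩
      margₑ u (W ∪ A) + marg W A       ≤⟨ +-mono-≤ (margₑ-antitone u (q⊆p∪q W A) u∈W∪A⇒u∈A)
                                                    (marg-≤-sumMargₑ A T xs distinct) ⟩
      margₑ u A + _                    ∎
      where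
      open ≤-Reasoning
      W : Subset n
      W = T ∩ added xs
      split : T ∩ (⁅ u ⁆ ∪ added xs) ≡ ⁅ u ⁆ ∪ W
      split = trans (∩-distribˡ-∪ T ⁅ u ⁆ (added xs))
                    (cong (_∪ W) (trans (∩-comm T ⁅ u ⁆) (p⊆q⇒p∩q≡p (x∈p⇒⁅x⁆⊆p (lookup⇒[]= u T T[u])))))
      u∈W∪A⇒u∈A : u ∈ W ∪ A → u ∈ A
      u∈W∪A⇒u∈A u∈W∪A = [ (λ u∈W → ⊥-elim (u∉xs (proj₂ (x∈p∩q⁻ T (added xs) u∈W)))) , id ]′
                          (x∈p∪q⁻ W A u∈W∪A)
    ... | false = begin
      marg (T ∩ (⁅ u ⁆ ∪ added xs)) A  ≡⟨ cong (λ X → marg X A) drop ⟩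
      marg W A                         ≤⟨ marg-≤-sumMargₑ A T xs distinct ⟩
      _                                ≡⟨ +-identityˡ _ ⟨
      0# + _                           ∎
      where
      open ≤-Reasoning
      W : Subset n
      W = T ∩ added xs
      drop : T ∩ (⁅ u ⁆ ∪ added xs) ≡ W
      drop = trans (∩-distribˡ-∪ T ⁅ u ⁆ (added xs))
                   (trans (cong (_∪ W) (x∉p⇒p∩⁅x⁆≡⊥ (lookup≡false⇒∉ T[u]))) (∪-identityˡ W))

  -- Unlike Sᵏ, this unfolds in step with Run, so facts about the state before
  -- the j-th addition follow by recursion on the run.
  after : (Fin 2 → Subset n) → List Step → Fin 2 → Subset n
  after S₀ []             = S₀
  after S₀ ((k , u) ∷ xs) = after (addTo S₀ k u) xs

  addTo-∪-collect : ∀ S₀ k₀ u xs k → addTo S₀ k₀ u k ∪ collect k xs ≡ S₀ k ∪ collect k ((k₀ , u) ∷ xs)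
  addTo-∪-collect S₀ k₀ u xs k with does (k ≟ k₀)
  ... | true  = ∪-assoc (S₀ k) ⁅ u ⁆ (collect k xs)
  ... | false = refl

  after≡∪collect : ∀ S₀ xs k → after S₀ xs k ≡ S₀ k ∪ collect k xs
  after≡∪collect S₀ []               k = sym (∪-identityʳ (S₀ k))
  after≡∪collect S₀ ((k₀ , u) ∷ xs) k =
    trans (after≡∪collect (addTo S₀ k₀ u) xs k) (addTo-∪-collect S₀ k₀ u xs k)

  after-initial : ∀ xs k → after (S initial) xs k ≡ collect k xs
  after-initial xs k = trans (after≡∪collect (S initial) xs k) (∪-identityˡ (collect k xs))

  S⊆addTo : ∀ S₀ k₀ u k → S₀ k ⊆ addTo S₀ k₀ u k
  S⊆addTo S₀ k₀ u k with does (k ≟ k₀)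
  ... | true  = p⊆p∪q ⁅ u ⁆
  ... | false = id

  Active : State → Set
  Active s = ∀ k → cost (S s k) < B → k ∈ J s

  active-initial : Active initial
  active-initial _ _ = ∈⊤

  module _ (positive : ∀ u → 0# < c u) where

    cost-mono : ∀ {X Y} → X ⊆ Y → cost X ≤ cost Y
    cost-mono {X} {Y} X⊆Y = sumFin-mono-≤ n term
      where
      term : ∀ v → (if lookup X v then c v else 0#) ≤ (if lookup Y v then c v else 0#)
      term v with lookup X v in X[v] | lookup Y v in Y[v]
      ... | true  | true  = ≤-reflexive refl
      ... | true  | false = ⊥-elim (lookup≡false⇒∉ Y[v] (X⊆Y (lookup⇒[]= v X X[v])))
      ... | false | true  = proj₁ (positive v)
      ... | false | false = ≤-reflexive refl

    -- k stays active whichever branch of NextJ applies; as membership in J' is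
    -- decidable, the resulting double negation suffices.
    active-step : ∀ {s k₀ u J'} → Active s → NextJ s k₀ u J' →
                  Active (st (addTo (S s) k₀ u) (N s - u) J')
    active-step {s} {k₀} {u} {J'} active (full , notFull) k under =
      decidable-stable (k ∈? J') λ k∉J' → k∉J' (staysIfNotFull (k∉J' ∘′ staysIfFull))
      where
      k∈J : k ∈ J s
      k∈J = active k (≤-<-trans (cost-mono (S⊆addTo (S s) k₀ u k)) under)
      staysIfFull : B ≤ cost (addTo (S s) k₀ u k₀) → k ∈ J'
      staysIfFull B≤ = subst (k ∈_) (sym (full B≤)) (x∈p∧x≢y⇒x∈p-y k∈J λ { refl → <⇒≱ under B≤ })
      staysIfNotFull : ¬ (B ≤ cost (addTo (S s) k₀ u k₀)) → k ∈ J'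
      staysIfNotFull B≰ = subst (k ∈_) (sym (notFull B≰)) k∈J

    greedy-choice-after : ∀ {s xs} → Active s → Run s xs → ∀ j k →
      let Sⱼ = after (S s) (take (toℕ j) xs) in
      cost (Sⱼ k) < B → margₑ (elem xs j) (Sⱼ k) ≤ margₑ (elem xs j) (Sⱼ (proj₁ (List.lookup xs j)))
    greedy-choice-after active (step _ u _ (_ , u∈N , best) _ _ _) zero k under =
      *-inverse-cancelʳ-≤ (positive u) (best k u (active k under) u∈N)
    greedy-choice-after {s} active (step k₀ u J' _ _ next run) (suc j) k under =
      greedy-choice-after (active-step {s} {k₀} {u} {J'} active next) run j k under

    greedy-choice : ∀ {xs} → Run initial xs → ∀ j k →
      cost (Sᵏ xs k (toℕ j)) < B →
      margₑ (elem xs j) (Sᵏ xs k (toℕ j)) ≤ margₑ (elem xs j) (Sᵏ xs (proj₁ (List.lookup xs j)) (toℕ j))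
    greedy-choice {xs} run j k under =
      subst₂ (λ X Y → margₑ (elem xs j) X ≤ margₑ (elem xs j) Y) (from-initial k) (from-initial _)
        (greedy-choice-after active-initial run j k (subst (λ X → cost X < B) (sym (from-initial k)) under))
      where
      from-initial : ∀ k' → after (S initial) (take (toℕ j) xs) k' ≡ Sᵏ xs k' (toℕ j)
      from-initial = after-initial (take (toℕ j) xs)

  added⊆N : ∀ {s xs} → Run s xs → added xs ⊆ N s
  added⊆N (stop-exhausted _)                          = ⊆-min _
  added⊆N (stop-nonpos _ _ _ _)                       = ⊆-min _
  added⊆N {s} (step _ u _ (_ , u∈N , _) _ _ run) x∈ =
    [ x∈p⇒⁅x⁆⊆p u∈N , p─q⊆p (N s) ⁅ u ⁆ ∘′ added⊆N run ]′ (x∈p∪q⁻ ⁅ u ⁆ _ x∈)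

  run-distinct : ∀ {s xs} → Run s xs → Distinct xs
  run-distinct (stop-exhausted _)        = []
  run-distinct (stop-nonpos _ _ _ _)     = []
  run-distinct {s} (step _ u _ _ _ _ run) = (x∉p-x (N s) ∘′ added⊆N run) ∷ run-distinct run

  elem∈added : ∀ xs j → elem xs j ∈ added xs
  elem∈added ((_ , u) ∷ xs) zero    = p⊆p∪q (added xs) (x∈⁅x⁆ u)
  elem∈added ((_ , u) ∷ xs) (suc j) = q⊆p∪q ⁅ u ⁆ (added xs) (elem∈added xs j)

  Sᵏ⊆added : ∀ xs k i → Sᵏ xs k i ⊆ added xs
  Sᵏ⊆added xs              k zeroℕ   = ⊆-min _
  Sᵏ⊆added []              k (suc i) = ⊆-min _
  Sᵏ⊆added ((k₀ , u) ∷ xs) k (suc i) with does (k ≟ k₀)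
  ... | true  = ∪-monoʳ-⊆ ⁅ u ⁆ (Sᵏ⊆added xs k i)
  ... | false = q⊆p∪q ⁅ u ⁆ (added xs) ∘′ Sᵏ⊆added xs k i

  Sᵏ-mono : ∀ xs k {j i} → j ≤ℕ i → Sᵏ xs k j ⊆ Sᵏ xs k i
  Sᵏ-mono xs              k z≤n       = ⊆-min _
  Sᵏ-mono []              k (s≤s _)   = id
  Sᵏ-mono ((k₀ , u) ∷ xs) k (s≤s j≤i) with does (k ≟ k₀)
  ... | true  = ∪-monoʳ-⊆ ⁅ u ⁆ (Sᵏ-mono xs k j≤i)
  ... | false = Sᵏ-mono xs k j≤i

  owner : ∀ {xs} → Distinct xs → ∀ k i j → elem xs j ∈ Sᵏ xs k i →
          toℕ j <ℕ i × proj₁ (List.lookup xs j) ≡ k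
  owner (_ ∷ _) k zeroℕ j u∈ = ⊥-elim (∉⊥ u∈)
  owner {(k₀ , u) ∷ xs} (u∉xs ∷ distinct) k (suc i) j u∈ with k ≟ k₀ | j
  ... | yes k≡k₀ | zero  = s≤s z≤n , sym k≡k₀
  ... | no _     | zero  = ⊥-elim (u∉xs (Sᵏ⊆added xs k i u∈))
  ... | no _     | suc j = map₁ s≤s (owner distinct k i j u∈)
  ... | yes _    | suc j with x∈p∪q⁻ ⁅ u ⁆ _ u∈
  ...   | inj₁ x∈⁅u⁆ = ⊥-elim (u∉xs (subst (_∈ added xs) (x∈⁅y⁆⇒x≡y u x∈⁅u⁆) (elem∈added xs j)))
  ...   | inj₂ x∈    = map₁ s≤s (owner distinct k i j x∈)

  if-mono-≤ : ∀ {p : Subset n} {x a b} → (x ∈ p → a ≤ b) →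
              (if lookup p x then a else 0#) ≤ (if lookup p x then b else 0#)
  if-mono-≤ {p} {x} a≤b with lookup p x in p[x]
  ... | true  = a≤b (lookup⇒[]= x p p[x])
  ... | false = ≤-reflexive refl

  margₑ-≤-margₑ-when-added : Submodular → (∀ u → 0# < c u) → ∀ {xs} → Run initial xs → ∀ k i →
    cost (Sᵏ xs k (i ∸ 1)) < B → ∀ j → elem xs j ∈ Sᵏ xs (other k) i →
    margₑ (elem xs j) (Sᵏ xs k i) ≤ margₑ (elem xs j) (Sᵏ xs (other k) (toℕ j))
  margₑ-≤-margₑ-when-added submodular positive {xs} run k i under j u∈Sₗ = begin
    margₑ u (Sᵏ xs k i)         ≤⟨ margₑ-antitone submodular u (Sᵏ-mono xs k (ℕ.<⇒≤ j<i)) (⊥-elim ∘′ u∉Sₖ) ⟩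
    margₑ u (Sᵏ xs k (toℕ j))   ≤⟨ greedy-choice positive run j k
                                     (≤-<-trans (cost-mono positive (Sᵏ-mono xs k (m<n⇒m≤n∸1 j<i))) under) ⟩
    margₑ u (Sᵏ xs kⱼ (toℕ j))  ≡⟨ cong (λ k′ → margₑ u (Sᵏ xs k′ (toℕ j))) kⱼ≡ℓ ⟩
    margₑ u (Sᵏ xs (other k) (toℕ j)) ∎
    where
    open ≤-Reasoning
    u : Fin n
    u = elem xs j
    kⱼ : Fin 2
    kⱼ = proj₁ (List.lookup xs j)
    distinct : Distinct xs
    distinct = run-distinct run
    j<i : toℕ j <ℕ i
    j<i = proj₁ (owner distinct (other k) i j u∈Sₗ)
    kⱼ≡ℓ : kⱼ ≡ other k
    kⱼ≡ℓ = proj₂ (owner distinct (other k) i j u∈Sₗ)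
    u∉Sₖ : u ∉ Sᵏ xs k i
    u∉Sₖ u∈Sₖ = other-≢ k (trans (sym (proj₂ (owner distinct k i j u∈Sₖ))) kⱼ≡ℓ)

lemma7 : (F : OrderedField) → let open OrderedField F in
    (n : ℕ) (f : Subset n → Carrier) (c : Fin n → Carrier) (B : Carrier) →
    let open TwinGreedy F f c B in
    NonNegative → Submodular → (∀ u → 0# < c u) →
    (steps : List (Fin 2 × Fin n)) → Run initial steps →
    (k : Fin 2) → (i : ℕ) → 1 ≤ℕ i → i ≤ℕ length steps →
    cost (Sᵏ steps k (i ∸ 1)) < B →
    (T : Subset n) → T ⊆ Sᵏ steps (other k) i →
    marg T (Sᵏ steps k i) ≤ rhsSum steps (other k) T
lemma7 F n f c B _ submodular positive steps run k i _ _ under T T⊆Sₗ = begin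
  marg T (Sᵏ steps k i)                  ≡⟨ cong (λ X → marg X (Sᵏ steps k i)) T∩added≡T ⟨
  marg (T ∩ added steps) (Sᵏ steps k i)  ≤⟨ marg-≤-sumMargₑ submodular (Sᵏ steps k i) T steps (run-distinct run) ⟩
  sumMargₑ steps T (Sᵏ steps k i)        ≤⟨ sumFin-mono-≤ (length steps) (λ j →
                                              if-mono-≤ (margₑ-≤-margₑ-when-added submodular positive run k i under j ∘′ T⊆Sₗ)) ⟩
  rhsSum steps (other k) T               ∎
  where
  open OrderedField F
  open TwinGreedy F f c B
  open OrderedFieldProperties F using (sumFin-mono-≤)
  open TwinGreedyProperties F f c B
  open ≤-Reasoning
  T∩added≡T : T ∩ added steps ≡ T
  T∩added≡T = p⊆q⇒p∩q≡p (Sᵏ⊆added steps (other k) i ∘′ T⊆Sₗ)
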